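{- Let $V_1,\dots,V_p$ be pairwise disjoint finite sets, $\mathcal{H}_i\subseteq 2^{V_i}$ transversal-free hypergraphs, and $\mathcal{H}=\mathcal{H}_1\boxplus\dots\boxplus\mathcal{H}_p\subseteq 2^V$, $V=V_1\cup\dots\cup V_p$. Then $\mathcal{H}$ is transversal-free, and for every position $\mathbf{a}\in\mathbb{Z}_+^V$ and every move $\mathbf{a}\to\mathbf{b}$ of Nim$_\mathcal{H}$: (i) $h(\mathbf{a})>h(\mathbf{b})\geq M(\mathbf{a})\geq M(\mathbf{b})$; (ii) $v(M(\mathbf{a}),Y(\mathbf{a}))<M(\mathbf{a})$ if and only if $M(\mathbf{a})>\binom{Y(\mathbf{a})+1}{2}$; (iii) $Y(\mathbf{b})\geq M(\mathbf{a})-M(\mathbf{b})$.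
   Context: A hypergraph on a finite set $W$ is a family of nonempty subsets of $W$ (edges) covering $W$. An edge is transversal if it meets every edge; a hypergraph is transversal-free if it has no transversal edge. In Nim$_\mathcal{F}$ a move $\mathbf{x}\to\mathbf{x}'$ on $\mathbb{Z}_+^W$ chooses an edge $F$ and has $x'_i<x_i$ for $i\in F$, $x'_i=x_i$ otherwise. Height $h_\mathcal{F}(\mathbf{x})$: maximum number of consecutive moves from $\mathbf{x}$; $m(\mathbf{x})=\min_ix_i$; $y_\mathcal{F}(\mathbf{x})=h_\mathcal{F}(\mathbf{x}-m(\mathbf{x})\mathbf{e})$, $\mathbf{e}$ all-ones. Selective compound: $\mathcal{H}_1\boxplus\dots\boxplus\mathcal{H}_p=\{\bigcup_iH^i\mid H^i\in\mathcal{H}_i\cup\{\emptyset\}\}\setminus\{\emptyset\}$. For $\mathbf{x}=(\mathbf{x}^1,\dots,\mathbf{x}^p)$ with $\mathbf{x}^i\in\mathbb{Z}_+^{V_i}$: $M(\mathbf{x})=\sum_im(\mathbf{x}^i)$, $Y(\mathbf{x})=\sum_iy_{\mathcal{H}_i}(\mathbf{x}^i)$, $h(\mathbf{x})=\sum_ih_{\mathcal{H}_i}(\mathbf{x}^i)$. Also $v(m,y)=\binom{y+1}{2}+((m-\binom{y+1}{2}-1)\bmod(y+1))$. -}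

module Defs where

open import Data.Nat using (ℕ; zero; suc; _+_; _⊓_; _∸_)
open import Data.Nat.Combinatorics using (_C_)
open import Data.Integer as ℤ using (ℤ; +_)
open import Data.Integer.DivMod using (_%ℕ_)
open import Data.Fin using (Fin; zero; suc)
open import Data.Bool using (Bool; true; false)
open import Data.Maybe using (Maybe; just; nothing)
open import Data.Product using (Σ; ∃; _×_; _,_)
open import Data.List using (tabulate)
open import Data.Nat.ListAction using (sum)
open import Relation.Binary.PropositionalEquality using (_≡_)
open import Relation.Nullary using (¬_)

Hypergraph : Set → Set₁
Hypergraph W = (W → Bool) → Set

Nonempty : {W : Set} → (W → Bool) → Set
Nonempty {W} E = ∃ λ (w : W) → E w ≡ true

IsHypergraph : {W : Set} → Hypergraph W → Set
IsHypergraph {W} H =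
  (∀ E → H E → Nonempty E) × (∀ (w : W) → ∃ λ E → H E × E w ≡ true)

Meets : {W : Set} → (W → Bool) → (W → Bool) → Set
Meets {W} E F = ∃ λ (w : W) → E w ≡ true × F w ≡ true

Transversal : {W : Set} → Hypergraph W → (W → Bool) → Set
Transversal H E = ∀ F → H F → Meets E F

TransversalFree : {W : Set} → Hypergraph W → Set
TransversalFree H = ∀ E → H E → ¬ Transversal H E

Move : {W : Set} → Hypergraph W → (W → ℕ) → (W → ℕ) → Set
Move {W} F x x' = ∃ λ E → F E
  × (∀ (w : W) → E w ≡ true → suc (x' w) Data.Nat.≤ x w)
  × (∀ (w : W) → E w ≡ false → x' w ≡ x w)

data Chain {W : Set} (F : Hypergraph W) : (W → ℕ) → ℕ → Set where
  stop : ∀ {x} → Chain F x 0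
  step : ∀ {x x' k} → Move F x x' → Chain F x' k → Chain F x (suc k)

IsHeight : {W : Set} → Hypergraph W → (W → ℕ) → ℕ → Set
IsHeight F x k = Chain F x k × (∀ j → Chain F x j → j Data.Nat.≤ k)

-- minimum over a finite family (convention 0 for the empty family, never used)
minF : ∀ {n} → (Fin n → ℕ) → ℕ
minF {zero} f = 0
minF {suc zero} f = f zero
minF {suc (suc n)} f = f zero ⊓ minF (λ i → f (suc i))

sumF : ∀ {p} → (Fin p → ℕ) → ℕ
sumF f = sum (tabulate f)

shiftDown : ∀ {n} → (Fin n → ℕ) → (Fin n → ℕ)
shiftDown x i = x i ∸ minF x

-- Selective compound of H_1, ..., H_p on V = disjoint union of V_i = Fin (n i)
Vert : (p : ℕ) → (Fin p → ℕ) → Set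
Vert p n = Σ (Fin p) (λ i → Fin (n i))

selEdge : ∀ {m} {H : Hypergraph (Fin m)} →
  Maybe (Σ (Fin m → Bool) H) → Fin m → Bool
selEdge nothing v = false
selEdge (just (e , _)) v = e v

compound : {p : ℕ} {n : Fin p → ℕ} →
  ((i : Fin p) → Hypergraph (Fin (n i))) → Hypergraph (Vert p n)
compound {p} {n} H E =
  (Σ ((i : Fin p) → Maybe (Σ (Fin (n i) → Bool) (H i))) λ sel →
     ∀ i v → E (i , v) ≡ selEdge {H = H i} (sel i) v)
  × Nonempty E

comp : {p : ℕ} {n : Fin p → ℕ} → (Vert p n → ℕ) → (i : Fin p) → Fin (n i) → ℕ
comp x i v = x (i , v)

vfun : ℕ → ℕ → ℕ
vfun m y = (suc y C 2) + (((+ m) ℤ.- (+ (suc y C 2)) ℤ.- (+ 1)) %ℕ suc y)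

-- A transversal-free hypergraph has, for every edge e, an edge disjoint from e; so after a move
-- along e the position is unchanged on some edge F, and from there one can keep playing on F
-- for as many moves as the old minimum.  Applied componentwise to a move of the compound,
-- whose restriction to each V_i is either a move of Nim_{H_i} or a pass, this gives
-- m(a^i) ≤ h(b^i) and m(a^i) - m(b^i) ≤ y(b^i); summing over i yields (i) and (iii).
-- Part (ii) is arithmetic: once M > binom(Y+1,2), the residue in v(M,Y) is at most
-- M - binom(Y+1,2) - 1.
module Submission where

open import Defs
open import Data.Bool as Bool using (Bool; true; false; if_then_else_)
open import Data.Empty using (⊥; ⊥-elim)
open import Data.Fin using (Fin; zero; suc; _≟_; fromℕ<)
open import Data.Fin.Properties using (any?)
open import Data.Integer as ℤ using (+_; _⊖_)
open import Data.Integer.Properties using ([+m]-[+n]≡m⊖n; ⊖-≥)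
open import Data.Maybe using (Maybe; just; nothing)
open import Data.Nat using (ℕ; zero; suc; _+_; _∸_; _<_; _≤_; _≤?_; pred; s≤s)
open import Data.Nat.Combinatorics using (_C_)
open import Data.Nat.DivMod using (_%_; m%n≤m)
open import Data.Nat.Properties hiding (_≟_)
open import Algebra.Properties.CommutativeSemigroup +-commutativeSemigroup using (interchange)
open import Data.Product using (Σ; ∃; _×_; _,_; proj₁)
open import Data.Sum using (_⊎_; inj₁; inj₂)
open import Function using (_∘_)
open import Function.Bundles using (_⇔_; mk⇔)
open import Relation.Binary.PropositionalEquality
open import Relation.Nullary using (¬_; Dec; yes; no)
open import Relation.Nullary.Decidable using (decidable-stable; _×-dec_)
open import Relation.Nullary.Negation using (¬¬-map)

module _ {W : Set} {H : Hypergraph W} where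

  move-≤ : ∀ {x y} → Move H x y → ∀ w → y w ≤ x w
  move-≤ (E , _ , lowered , unchanged) w with E w in Ew
  ... | true  = <⇒≤ (lowered w Ew)
  ... | false = ≤-reflexive (unchanged w Ew)

  chain-resp-≗ : ∀ {x y k} → x ≗ y → Chain H x k → Chain H y k
  chain-resp-≗ x≗y stop = stop
  chain-resp-≗ x≗y (step (E , HE , lowered , unchanged) c) =
    step (E , HE , (λ w Ew → subst (_ ≤_) (x≗y w) (lowered w Ew))
                 , (λ w Ew → trans (unchanged w Ew) (x≗y w))) c

  chain-alongEdge : ∀ {F x k} → H F → (∀ w → F w ≡ true → k ≤ x w) → Chain H x k
  chain-alongEdge {k = zero} _ _ = stop
  chain-alongEdge {F} {x} {suc k} HF k<x =
    step (F , HF , lowered , unchanged) (chain-alongEdge HF k≤x′)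
    where
    x′ : W → ℕ
    x′ w = if F w then pred (x w) else x w
    pred<self : ∀ {m} → suc k ≤ m → suc (pred m) ≤ m
    pred<self (s≤s _) = ≤-refl
    lowered : ∀ w → F w ≡ true → suc (x′ w) ≤ x w
    lowered w Fw rewrite Fw = pred<self (k<x w Fw)
    unchanged : ∀ w → F w ≡ false → x′ w ≡ x w
    unchanged w Fw rewrite Fw = refl
    k≤x′ : ∀ w → F w ≡ true → k ≤ x′ w
    k≤x′ w Fw rewrite Fw = pred-mono-≤ (k<x w Fw)

  height-move-< : ∀ {x y k j} → IsHeight H x k → IsHeight H y j → Move H x y → j < k
  height-move-< (_ , maximal) (chain , _) mv = maximal _ (step mv chain)

  height-resp-≗ : ∀ {x y k j} → x ≗ y → IsHeight H x k → IsHeight H y j → k ≡ j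
  height-resp-≗ x≗y (chainₓ , maximalₓ) (chainᵧ , maximalᵧ) =
    ≤-antisym (maximalᵧ _ (chain-resp-≗ x≗y chainₓ))
              (maximalₓ _ (chain-resp-≗ (sym ∘ x≗y) chainᵧ))

  height-≥-alongEdge : ∀ {F x k j} → IsHeight H x k → H F → (∀ w → F w ≡ true → j ≤ x w) → j ≤ k
  height-≥-alongEdge (_ , maximal) HF j≤x = maximal _ (chain-alongEdge HF j≤x)

  AgreeOnEdge : (W → ℕ) → (W → ℕ) → Set
  AgreeOnEdge x y = ∃ λ F → H F × (∀ w → F w ≡ true → y w ≡ x w)

  ≗⇒agreeOnEdge : ∀ {x y} → IsHypergraph H → W → y ≗ x → AgreeOnEdge x y
  ≗⇒agreeOnEdge (_ , covering) w y≗x =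
    let (F , HF , _) = covering w in F , HF , λ v _ → y≗x v

MoveOrPass : {W : Set} → Hypergraph W → (W → ℕ) → (W → ℕ) → Set
MoveOrPass H x y = (y ≗ x) ⊎ Move H x y

module _ {W : Set} {H : Hypergraph W} {x y : W → ℕ} where

  moveOrPass⇒≤ : MoveOrPass H x y → ∀ w → y w ≤ x w
  moveOrPass⇒≤ (inj₁ y≗x) w = ≤-reflexive (y≗x w)
  moveOrPass⇒≤ (inj₂ mv)  w = move-≤ mv w

  moveOrPass⇒height-≤ : ∀ {k j} → IsHeight H x k → IsHeight H y j → MoveOrPass H x y → j ≤ k
  moveOrPass⇒height-≤ hx hy (inj₁ y≗x) = ≤-reflexive (height-resp-≗ y≗x hy hx)
  moveOrPass⇒height-≤ hx hy (inj₂ mv)  = <⇒≤ (height-move-< hx hy mv)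

minF-≤ : ∀ {m} (f : Fin m → ℕ) (i : Fin m) → minF f ≤ f i
minF-≤ {suc zero}    f zero    = ≤-refl
minF-≤ {suc (suc m)} f zero    = m⊓n≤m _ _
minF-≤ {suc (suc m)} f (suc i) = ≤-trans (m⊓n≤n _ _) (minF-≤ (f ∘ suc) i)

minF-mono-≤ : ∀ {m} {f g : Fin m → ℕ} → (∀ i → f i ≤ g i) → minF f ≤ minF g
minF-mono-≤ {zero}        f≤g = ≤-refl
minF-mono-≤ {suc zero}    f≤g = f≤g zero
minF-mono-≤ {suc (suc m)} f≤g = ⊓-mono-≤ (f≤g zero) (minF-mono-≤ (f≤g ∘ suc))

sumF-mono-≤ : ∀ {p} {f g : Fin p → ℕ} → (∀ i → f i ≤ g i) → sumF f ≤ sumF g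
sumF-mono-≤ {zero}  f≤g = ≤-refl
sumF-mono-≤ {suc p} f≤g = +-mono-≤ (f≤g zero) (sumF-mono-≤ (f≤g ∘ suc))

sumF-mono-< : ∀ {p} {f g : Fin p → ℕ} → (∀ i → f i ≤ g i) → ∀ i → f i < g i → sumF f < sumF g
sumF-mono-< f≤g zero    fi<gi = +-mono-<-≤ fi<gi (sumF-mono-≤ (f≤g ∘ suc))
sumF-mono-< f≤g (suc i) fi<gi = +-mono-≤-< (f≤g zero) (sumF-mono-< (f≤g ∘ suc) i fi<gi)

sumF-+ : ∀ {p} (f g : Fin p → ℕ) → sumF (λ i → f i + g i) ≡ sumF f + sumF g
sumF-+ {zero}  f g = refl
sumF-+ {suc p} f g = trans (cong (_+_ (f zero + g zero)) (sumF-+ (f ∘ suc) (g ∘ suc)))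
                           (interchange (f zero) (g zero) (sumF (f ∘ suc)) (sumF (g ∘ suc)))

module _ {m : ℕ} {H : Hypergraph (Fin m)} where

  meets? : (e F : Fin m → Bool) → Dec (Meets e F)
  meets? e F = any? λ w → (e w Bool.≟ true) ×-dec (F w Bool.≟ true)

  ¬meets⇒disjoint : ∀ {e F : Fin m → Bool} → ¬ Meets e F → ∀ w → F w ≡ true → e w ≡ false
  ¬meets⇒disjoint {e} ¬meets w Fw with e w in ew
  ... | true  = ⊥-elim (¬meets (w , ew , Fw))
  ... | false = refl

  transversalFree⇒¬¬disjointEdge : TransversalFree H → ∀ {e} → H e →
                                   ¬ ¬ (∃ λ F → H F × ¬ Meets e F)
  transversalFree⇒¬¬disjointEdge tf {e} He ¬disjoint = tf e He λ F HF →
    decidable-stable (meets? e F) λ ¬meets → ¬disjoint (F , HF , ¬meets)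

  move⇒¬¬agreeOnEdge : TransversalFree H → ∀ {x y} → Move H x y → ¬ ¬ AgreeOnEdge {H = H} x y
  move⇒¬¬agreeOnEdge tf (e , He , _ , unchanged) =
    ¬¬-map (λ (F , HF , ¬meets) → F , HF , λ w Fw → unchanged w (¬meets⇒disjoint ¬meets w Fw))
           (transversalFree⇒¬¬disjointEdge tf He)

  agreeOnEdge⇒minF≤height : ∀ {x y k} → AgreeOnEdge {H = H} x y → IsHeight H y k → minF x ≤ k
  agreeOnEdge⇒minF≤height {x} (F , HF , y≡x) hy =
    height-≥-alongEdge hy HF λ w Fw → subst (minF x ≤_) (sym (y≡x w Fw)) (minF-≤ x w)

  agreeOnEdge⇒minF≤shiftedHeight : ∀ {x y k} → AgreeOnEdge {H = H} x y →
                                   IsHeight H (shiftDown y) k → minF x ≤ k + minF y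
  agreeOnEdge⇒minF≤shiftedHeight {x} {y} {k} (F , HF , y≡x) hy = begin
    minF x                     ≤⟨ m≤n+m∸n (minF x) (minF y) ⟩
    minF y + (minF x ∸ minF y) ≤⟨ +-monoʳ-≤ (minF y) (height-≥-alongEdge hy HF minF-gap≤) ⟩
    minF y + k                 ≡⟨ +-comm (minF y) k ⟩
    k + minF y                 ∎
    where
    open ≤-Reasoning
    minF-gap≤ : ∀ w → F w ≡ true → minF x ∸ minF y ≤ y w ∸ minF y
    minF-gap≤ w Fw = ∸-monoˡ-≤ (minF y) (subst (minF x ≤_) (sym (y≡x w Fw)) (minF-≤ x w))

  -- The edge disjoint from e exists only up to double negation, which suffices because the
  -- conclusions are decidable inequalities.
  module _ (hyp : IsHypergraph H) (w₀ : Fin m) (tf : TransversalFree H) {x y : Fin m → ℕ} where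

    moveOrPass⇒¬¬agreeOnEdge : MoveOrPass H x y → ¬ ¬ AgreeOnEdge {H = H} x y
    moveOrPass⇒¬¬agreeOnEdge (inj₁ y≗x) ¬agree = ¬agree (≗⇒agreeOnEdge hyp w₀ y≗x)
    moveOrPass⇒¬¬agreeOnEdge (inj₂ mv)         = move⇒¬¬agreeOnEdge tf mv

    moveOrPass⇒minF≤height : ∀ {k} → MoveOrPass H x y → IsHeight H y k → minF x ≤ k
    moveOrPass⇒minF≤height x⇝y hy = decidable-stable (_ ≤? _)
      (¬¬-map (λ agree → agreeOnEdge⇒minF≤height agree hy) (moveOrPass⇒¬¬agreeOnEdge x⇝y))

    moveOrPass⇒minF≤shiftedHeight : ∀ {k} → MoveOrPass H x y → IsHeight H (shiftDown y) k →
                                    minF x ≤ k + minF y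
    moveOrPass⇒minF≤shiftedHeight x⇝y hy = decidable-stable (_ ≤? _)
      (¬¬-map (λ agree → agreeOnEdge⇒minF≤shiftedHeight agree hy) (moveOrPass⇒¬¬agreeOnEdge x⇝y))

module _ {p : ℕ} {n : Fin p → ℕ} {H : (i : Fin p) → Hypergraph (Fin (n i))} where

  single : (i : Fin p) → Σ _ (H i) → (j : Fin p) → Maybe (Σ _ (H j))
  single i e j with i ≟ j
  ... | yes refl = just e
  ... | no _     = nothing

  embed : (i : Fin p) → Σ _ (H i) → Vert p n → Bool
  embed i e (j , v) = selEdge (single i e j) v

  embed-self : ∀ i (e : Σ _ (H i)) u → proj₁ e u ≡ true → embed i e (i , u) ≡ true
  embed-self i e u eu with i ≟ i
  ... | yes refl = eu
  ... | no i≢i   = ⊥-elim (i≢i refl)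

  embed-support : ∀ i (e : Σ _ (H i)) j v → embed i e (j , v) ≡ true →
                  ∃ λ u → proj₁ e u ≡ true × _≡_ {A = Vert p n} (i , u) (j , v)
  embed-support i e j v ejv with i ≟ j
  ... | yes refl = v , ejv , refl
  embed-support i e j v () | no _

  embed∈compound : ∀ i {F} → (∀ E → H i E → Nonempty E) → (HF : H i F) →
                   compound H (embed i (F , HF))
  embed∈compound i nonempty HF =
    let (u , Fu) = nonempty _ HF in
    ((single i (_ , HF) , λ _ _ → refl) , (i , u) , embed-self i (_ , HF) u Fu)

  compound-transversalFree : (∀ i → IsHypergraph (H i)) → (∀ i → TransversalFree (H i)) →
                             TransversalFree (compound H)
  compound-transversalFree hyp tf E ((sel , E≡sel) , (i , v) , Eiv) E-transversal =
    restriction-transversal (sel i) (E≡sel i) (trans (sym (E≡sel i v)) Eiv)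
    where
    restriction-transversal : (s : Maybe (Σ _ (H i))) → (∀ u → E (i , u) ≡ selEdge s u) →
                              selEdge s v ≡ true → ⊥
    restriction-transversal nothing _ ()
    restriction-transversal (just (e , He)) E≡e _ = tf i e He e-transversal
      where
      e-transversal : Transversal (H i) e
      e-transversal F HF with E-transversal (embed i (F , HF)) (embed∈compound i (proj₁ (hyp i)) HF)
      ... | (j , w) , Ejw , ejw with embed-support i (F , HF) j w ejw
      ... | u , Fu , refl = u , trans (sym (E≡e u)) Ejw , Fu

  compoundMove-restrict : ∀ {a b} → Move (compound H) a b →
                          ∀ i → MoveOrPass (H i) (comp a i) (comp b i)
  compoundMove-restrict {a} {b} (E , ((sel , E≡sel) , _) , lowered , unchanged) i =
    restrict (sel i) (E≡sel i)
    where
    restrict : (s : Maybe (Σ _ (H i))) → (∀ v → E (i , v) ≡ selEdge s v) →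
               MoveOrPass (H i) (comp a i) (comp b i)
    restrict nothing E≡∅ = inj₁ λ v → unchanged (i , v) (E≡∅ v)
    restrict (just (e , He)) E≡e =
      inj₂ (e , He , (λ v ev → lowered (i , v) (trans (E≡e v) ev))
                   , (λ v ev → unchanged (i , v) (trans (E≡e v) ev)))

  compoundMove-touches : ∀ {a b} → Move (compound H) a b → ∃ λ i → Move (H i) (comp a i) (comp b i)
  compoundMove-touches mv@(_ , (_ , (i , v) , Eiv) , lowered , _) with compoundMove-restrict mv i
  ... | inj₁ b≗a = ⊥-elim (<-irrefl (b≗a v) (lowered (i , v) Eiv))
  ... | inj₂ mvᵢ = i , mvᵢ

vfun<⇔ : ∀ m y → (vfun m y < m ⇔ suc y C 2 < m)
vfun<⇔ m y = mk⇔ (≤-<-trans (m≤m+n T _)) bounded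
  where
  T : ℕ
  T = suc y C 2
  offset : ∀ d → + (suc T + d) ℤ.- + T ℤ.- + 1 ≡ + d
  offset d = cong (ℤ._- + 1) (begin
    + (suc T + d) ℤ.- + T ≡⟨ cong (λ z → + z ℤ.- + T) (sym (+-suc T d)) ⟩
    + (T + suc d) ℤ.- + T ≡⟨ [+m]-[+n]≡m⊖n (T + suc d) T ⟩
    (T + suc d) ⊖ T       ≡⟨ ⊖-≥ (m≤m+n T (suc d)) ⟩
    + (T + suc d ∸ T)     ≡⟨ cong +_ (m+n∸m≡n T (suc d)) ⟩
    + suc d               ∎)
    where open ≡-Reasoning
  bounded : T < m → vfun m y < m
  bounded T<m with m≤n⇒∃[o]m+o≡n T<m
  ... | d , refl = begin-strict
    vfun (suc T + d) y ≡⟨ cong (λ z → T + z ℤ.%ℕ suc y) (offset d) ⟩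
    T + d % suc y      ≤⟨ +-monoʳ-≤ T (m%n≤m d (suc y)) ⟩
    T + d              <⟨ n<1+n (T + d) ⟩
    suc T + d          ∎
    where open ≤-Reasoning

lemma5 : (p : ℕ) (n : Fin p → ℕ) → (∀ i → 1 ≤ n i)
    → (H : (i : Fin p) → Hypergraph (Fin (n i)))
    → (∀ i → IsHypergraph (H i))
    → (∀ i → TransversalFree (H i))
    → (hgt : (i : Fin p) → (Fin (n i) → ℕ) → ℕ)
    → (∀ i x → IsHeight (H i) x (hgt i x))
    → TransversalFree (compound H)
      × (∀ (a b : Vert p n → ℕ) → Move (compound H) a b →
          let M : (Vert p n → ℕ) → ℕ
              M x = sumF (λ i → minF (comp x i))
              Y : (Vert p n → ℕ) → ℕ
              Y x = sumF (λ i → hgt i (shiftDown (comp x i)))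
              h : (Vert p n → ℕ) → ℕ
              h x = sumF (λ i → hgt i (comp x i))
          in (h b < h a × M a ≤ h b × M b ≤ M a)
             × (vfun (M a) (Y a) < M a ⇔ suc (Y a) C 2 < M a)
             × (M a ≤ Y b + M b))
lemma5 p n n≥1 H hyp tf hgt isH = compound-transversalFree hyp tf , λ a b mv →
  let component = compoundMove-restrict mv
      (i₀ , mvᵢ₀) = compoundMove-touches mv
      vertex : ∀ i → Fin (n i)
      vertex i = fromℕ< (n≥1 i)
  in ( sumF-mono-< (λ i → moveOrPass⇒height-≤ (isH i _) (isH i _) (component i))
                   i₀ (height-move-< (isH i₀ _) (isH i₀ _) mvᵢ₀)
     , sumF-mono-≤ (λ i → moveOrPass⇒minF≤height (hyp i) (vertex i) (tf i) (component i) (isH i _))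
     , sumF-mono-≤ (λ i → minF-mono-≤ (moveOrPass⇒≤ (component i))) )
   , vfun<⇔ (sumF λ i → minF (comp a i)) (sumF λ i → hgt i (shiftDown (comp a i)))
   , subst (_ ≤_) (sumF-+ (λ i → hgt i (shiftDown (comp b i))) (λ i → minF (comp b i)))
       (sumF-mono-≤ λ i →
          moveOrPass⇒minF≤shiftedHeight (hyp i) (vertex i) (tf i) (component i) (isH i _))
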